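{- Assume univalence and propositional truncation. Let $X := B\mathsf{Aut}(B\mathsf{Aut}(\mathbf{2}))$. Then the type $\prod_{x:X}(\mathsf{refl}_x = \mathsf{refl}_x)$ has an element that is not equal to $\lambda x.\,\mathsf{refl}_{\mathsf{refl}_x}$.
   Context: We work in intensional Martin-Löf type theory with a cumulative hierarchy of univalent universes and propositional truncation $\|{ - }\|$. For a type $Y$ in a universe $\mathcal{U}$, $B\mathsf{Aut}(Y) := \sum_{Z:\mathcal{U}}\|Z=Y\|$. This is a type in the next universe. $\mathbf{2}$ is the two-element type. -}

{-# OPTIONS --without-K #-}
module Defs where

open import Level using (Level; _⊔_; suc; zero; Setω)
open import Data.Product using (Σ; _,_; proj₁; proj₂)
open import Data.Bool using (Bool)
open import Relation.Binary.PropositionalEquality using (_≡_; refl)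

isContr : ∀ {ℓ} → Set ℓ → Set ℓ
isContr A = Σ A λ a → (b : A) → a ≡ b

isProp : ∀ {ℓ} → Set ℓ → Set ℓ
isProp A = (a b : A) → a ≡ b

fiber : ∀ {ℓ ℓ'} {A : Set ℓ} {B : Set ℓ'} → (A → B) → B → Set (ℓ ⊔ ℓ')
fiber {A = A} f b = Σ A λ a → f a ≡ b

isEquiv : ∀ {ℓ ℓ'} {A : Set ℓ} {B : Set ℓ'} → (A → B) → Set (ℓ ⊔ ℓ')
isEquiv {B = B} f = (b : B) → isContr (fiber f b)

_≃_ : ∀ {ℓ ℓ'} → Set ℓ → Set ℓ' → Set (ℓ ⊔ ℓ')
A ≃ B = Σ (A → B) isEquiv

idIsEquiv : ∀ {ℓ} (A : Set ℓ) → isEquiv (λ (a : A) → a)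
idIsEquiv A b = (b , refl) , λ { (a , refl) → refl }

idtoeqv : ∀ {ℓ} {A B : Set ℓ} → A ≡ B → A ≃ B
idtoeqv {A = A} refl = (λ a → a) , idIsEquiv A

Univalence : (ℓ : Level) → Set (suc ℓ)
Univalence ℓ = (A B : Set ℓ) → isEquiv (idtoeqv {ℓ} {A} {B})

UnivalenceAll : Setω
UnivalenceAll = (ℓ : Level) → Univalence ℓ

record PropTrunc : Setω where
  field
    ∥_∥   : ∀ {ℓ} → Set ℓ → Set ℓ
    ∣_∣   : ∀ {ℓ} {A : Set ℓ} → A → ∥ A ∥
    squash : ∀ {ℓ} {A : Set ℓ} → isProp ∥ A ∥
    rec   : ∀ {ℓ ℓ'} {A : Set ℓ} {P : Set ℓ'} → isProp P → (A → P) → ∥ A ∥ → P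

BAut : PropTrunc → ∀ {ℓ} → Set ℓ → Set (suc ℓ)
BAut pt {ℓ} Y = Σ (Set ℓ) λ Z → PropTrunc.∥_∥ pt (Z ≡ Y)

X : PropTrunc → Set (suc (suc zero))
X pt = BAut pt (BAut pt Bool)

{-# OPTIONS --without-K #-}
-- Every point y of BAut 2 has exactly one nontrivial loop: loops at
-- (W , s) correspond, by univalence, to self-equivalences of W, and W is
-- merely Bool, whose only self-equivalences are the identity and negation.
-- Being a proposition, this transfers to every point (Z , t) of X: each
-- z : Z carries a unique nontrivial loop H z, so H : (z : Z) → z ≡ z is a
-- homotopy id ~ id.  By function extensionality H is a loop at the identity
-- equivalence of Z, and by univalence that loop becomes a loop at refl in the
-- loop space of (Z , t), i.e. an element of refl ≡ refl.  Each of these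
-- passages is a section on paths, so the resulting 2-loop is refl only if H
-- is pointwise refl, which fails at any point of Z.
module Submission where

open import Defs
open import Data.Product using (Σ)
open import Relation.Nullary using (¬_)
open import Relation.Binary.PropositionalEquality using (_≡_; refl)

open import Level using (Level; _⊔_; Lift; lift; lower)
open import Data.Product using (_,_; proj₁; proj₂)
open import Data.Bool using (Bool; true; false; not)
open import Data.Bool.Properties using (not-involutive)
open import Data.Empty using (⊥-elim)
open import Data.Sum using (_⊎_; inj₁; inj₂)
open import Function using (_∘_)
open import Function.Definitions using (Injective)
open import Relation.Binary.PropositionalEquality
  using (sym; trans; cong; cong-app; subst)
open import Relation.Binary.PropositionalEquality.Properties
  using (trans-reflʳ; trans-symˡ; cong-∘)

private variable a b ℓ : Level

conjugate-refl : {A : Set a} {u v : A} (k : u ≡ v) (w : u ≡ u) →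
                 trans (sym k) (trans w k) ≡ refl → w ≡ refl
conjugate-refl refl w h = trans (sym (trans-reflʳ w)) h

naturality : {A : Set a} (G : A → A) (η : (e : A) → e ≡ G e) {e e' : A} (p : e ≡ e') →
             cong G p ≡ trans (sym (η e)) (trans p (η e'))
naturality G η {e} refl = sym (trans-symˡ (η e))

retraction-reflects : {A : Set a} {B : Set b} (r : B → A) (s : A → B) →
                      ((x : A) → r (s x) ≡ x) → {x : A} {y : B} → s x ≡ y → x ≡ r y
retraction-reflects r s ε {x} q = trans (sym (ε x)) (cong r q)

section-loop-refl : {A : Set a} {B : Set b} (s : A → B) (r : B → A) →
                    ((x : A) → x ≡ r (s x)) → {x : A} (p : x ≡ x) → cong s p ≡ refl → p ≡ refl
section-loop-refl s r η {x} p h =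
  conjugate-refl (η x) p (trans (sym (naturality (r ∘ s) η p)) (trans (cong-∘ p) (cong (cong r) h)))

contr→prop : {A : Set a} → isContr A → isProp A
contr→prop (c , h) x y = trans (sym (h x)) (h y)

-- Propositions are sets: every path x ≡ y equals the normal form built from P.
prop→set : {A : Set a} → isProp A → {x y : A} (p q : x ≡ y) → p ≡ q
prop→set {A = A} P {x} {y} p q = trans (normal p) (sym (normal q))
  where
  shift : {z w : A} (r : z ≡ w) → trans (P x z) r ≡ P x w
  shift refl = trans-reflʳ _
  cancel : {u v w : A} (k : u ≡ v) (r : v ≡ w) → trans (sym k) (trans k r) ≡ r
  cancel refl r = refl
  normal : (r : x ≡ y) → r ≡ trans (sym (P x x)) (P x y)
  normal r = trans (sym (cancel (P x x) r)) (cong (trans (sym (P x x))) (shift r))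

retract-contr : {A : Set a} {B : Set b} (to : A → B) (back : B → A) →
                ((x : A) → back (to x) ≡ x) → isContr B → isContr A
retract-contr to back r (c , h) = back c , λ x → trans (cong back (h (to x))) (r x)

equivInj : {A : Set a} {B : Set b} {f : A → B} → isEquiv f → Injective _≡_ _≡_ f
equivInj {f = f} e {x} {y} p = cong proj₁ (contr→prop (e (f y)) (x , p) (y , refl))

Σ-prop-path : {A : Set a} {P : A → Set b} → ((x : A) → isProp (P x)) → {x y : A} → x ≡ y →
              (t : P x) (t' : P y) → _≡_ {A = Σ A P} (x , t) (y , t')
Σ-prop-path Pp {x} refl t t' = cong (x ,_) (Pp x t t')

Σ-prop-path-proj₁ : {A : Set a} {P : A → Set b} (Pp : (x : A) → isProp (P x)) {x y : A}
                    (p : x ≡ y) (t : P x) (t' : P y) → cong proj₁ (Σ-prop-path Pp p t t') ≡ p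
Σ-prop-path-proj₁ Pp {x} refl t t' = base-refl (Pp x t t')
  where
  base-refl : {s s' : _} (q : s ≡ s') → cong proj₁ (cong (_,_ {B = _} x) q) ≡ refl
  base-refl refl = refl

Σ-prop-path-η : {A : Set a} {P : A → Set b} (Pp : (x : A) → isProp (P x)) {u v : Σ A P}
                (p : u ≡ v) → p ≡ Σ-prop-path Pp (cong proj₁ p) (proj₂ u) (proj₂ v)
Σ-prop-path-η Pp {u} refl =
  cong (cong (proj₁ u ,_)) (prop→set (Pp (proj₁ u)) refl (Pp _ (proj₂ u) (proj₂ u)))

not-isEquiv : isEquiv not
not-isEquiv b = (not b , not-involutive b) , λ { (true , refl) → refl ; (false , refl) → refl }

notE : Bool ≃ Bool
notE = not , not-isEquiv

injective-Bool-endo : (f : Bool → Bool) → Injective _≡_ _≡_ f →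
                      ((x : Bool) → f x ≡ x) ⊎ ((x : Bool) → f x ≡ not x)
injective-Bool-endo f inj with f true in e1 | f false in e2
... | true  | false = inj₁ λ { true → e1 ; false → e2 }
... | false | true  = inj₂ λ { true → e1 ; false → e2 }
... | true  | true  with () ← inj (trans e1 (sym e2))
... | false | false with () ← inj (trans e1 (sym e2))

module Univalent (U : UnivalenceAll) where

  ua : {A B : Set a} → A ≃ B → A ≡ B
  ua {a} {A} {B} e = proj₁ (proj₁ (U a A B e))

  ua-β : {A B : Set a} (e : A ≃ B) → idtoeqv (ua e) ≡ e
  ua-β {a} {A} {B} e = proj₂ (proj₁ (U a A B e))

  ua-η : {A B : Set a} (p : A ≡ B) → ua (idtoeqv p) ≡ p
  ua-η {a} {A} {B} p = equivInj (U a A B) (ua-β (idtoeqv p))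

  -- Postcomposition with an equivalence is an equivalence (by induction on ua e).
  postcomp-isEquiv : {A C : Set a} {D : Set b} (e : A ≃ C) →
                     isEquiv (λ (k : D → A) → proj₁ e ∘ k)
  postcomp-isEquiv {A = A} {C} {D} e =
    subst (λ e' → isEquiv (λ (k : D → A) → proj₁ e' ∘ k)) (ua-β e) (along (ua e))
    where
    along : (r : A ≡ C) → isEquiv (λ (k : D → A) → proj₁ (idtoeqv r) ∘ k)
    along refl = idIsEquiv (D → A)

  proj₁-isEquiv : {B : Set a} {Q : B → Set b} → ((x : B) → isContr (Q x)) →
                  isEquiv (λ (u : Σ B Q) → lift {ℓ = b} (proj₁ u))
  proj₁-isEquiv cQ w = ((lower w , proj₁ (cQ (lower w))) , refl) ,
    λ { ((x , q) , refl) → cong (λ q' → ((x , q') , refl)) (proj₂ (cQ x) q) }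

  -- Weak function extensionality: sections of the projection form a retract of
  -- the contractible fibre of postcomposition with it over the identity.
  Π-isContr : {B : Set a} {Q : B → Set b} → ((x : B) → isContr (Q x)) → isContr ((x : B) → Q x)
  Π-isContr {a} {b} {B} {Q} cQ =
    retract-contr to back (λ _ → refl) (postcomp-isEquiv {D = B} proj₁≃ lift)
    where
    proj₁≃ : Σ B Q ≃ Lift b B
    proj₁≃ = (λ u → lift (proj₁ u)) , proj₁-isEquiv cQ
    Section : Set (a ⊔ b)
    Section = fiber (λ (k : B → Σ B Q) → proj₁ proj₁≃ ∘ k) lift
    to : ((x : B) → Q x) → Section
    to s = (λ x → x , s x) , refl
    back : Section → (x : B) → Q x
    back (k , p) x = subst Q (cong lower (cong-app p x)) (proj₂ (k x))

  -- Every homotopy from f is cong-app of a path, since (g , f ~ g) is contractible.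
  cong-app-section : {A : Set a} {B : A → Set b} {f g : (x : A) → B x}
                     (h : (x : A) → f x ≡ g x) → Σ (f ≡ g) (λ p → cong-app p ≡ h)
  cong-app-section {A = A} {B} {f} {g} h =
    from-refl (g , h) (contr→prop homotopies-isContr (f , λ _ → refl) (g , h))
    where
    Homotopies : Set _
    Homotopies = Σ ((x : A) → B x) (λ g → (x : A) → f x ≡ g x)
    homotopies-isContr : isContr Homotopies
    homotopies-isContr = retract-contr pointwise unpointwise (λ _ → refl)
      (Π-isContr λ x → (f x , refl) , λ { (y , refl) → refl })
      where
      pointwise : Homotopies → (x : A) → Σ (B x) (λ y → f x ≡ y)
      pointwise (g , h) x = g x , h x
      unpointwise : ((x : A) → Σ (B x) (λ y → f x ≡ y)) → Homotopies
      unpointwise k = proj₁ ∘ k , proj₂ ∘ k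
    from-refl : (v : Homotopies) → (f , (λ _ → refl)) ≡ v →
                Σ (f ≡ proj₁ v) (λ p → cong-app p ≡ proj₂ v)
    from-refl _ refl = refl , refl

  funext : {A : Set a} {B : A → Set b} {f g : (x : A) → B x} → ((x : A) → f x ≡ g x) → f ≡ g
  funext h = proj₁ (cong-app-section h)

  cong-app-funext : {A : Set a} {B : A → Set b} {f g : (x : A) → B x}
                    (h : (x : A) → f x ≡ g x) → cong-app (funext h) ≡ h
  cong-app-funext h = proj₂ (cong-app-section h)

  Π-isProp : {A : Set a} {B : A → Set b} → ((x : A) → isProp (B x)) → isProp ((x : A) → B x)
  Π-isProp P f g = funext λ x → P x (f x) (g x)

  isContr-isProp : {A : Set a} → isProp (isContr A)
  isContr-isProp (c , h) (c' , h') =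
    Σ-prop-path (λ _ → Π-isProp λ _ → prop→set (contr→prop (c , h))) (h c') h h'

  isEquiv-isProp : {A : Set a} {B : Set b} (f : A → B) → isProp (isEquiv f)
  isEquiv-isProp f = Π-isProp λ _ → isContr-isProp

  ¬-isProp : {A : Set a} → isProp (¬ A)
  ¬-isProp = Π-isProp λ _ ()

  equivEq : {A : Set a} {B : Set b} (e e' : A ≃ B) → ((x : A) → proj₁ e x ≡ proj₁ e' x) → e ≡ e'
  equivEq e e' h = Σ-prop-path isEquiv-isProp (funext h) (proj₂ e) (proj₂ e')

  Bool-automorphism : (e : Bool ≃ Bool) → (e ≡ idtoeqv refl) ⊎ (e ≡ notE)
  Bool-automorphism e with injective-Bool-endo (proj₁ e) (equivInj (proj₂ e))
  ... | inj₁ h = inj₁ (equivEq e _ h)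
  ... | inj₂ h = inj₂ (equivEq e notE h)

  identity-loop : {Z : Set a} → ((z : Z) → z ≡ z) → idtoeqv {A = Z} refl ≡ idtoeqv refl
  identity-loop {Z = Z} H = Σ-prop-path isEquiv-isProp (funext H) (idIsEquiv Z) (idIsEquiv Z)

  identity-loop-faithful : {Z : Set a} (H : (z : Z) → z ≡ z) →
                           identity-loop H ≡ refl → H ≡ (λ z → refl)
  identity-loop-faithful {Z = Z} H ρ≡refl =
    retraction-reflects cong-app funext cong-app-funext
      (retraction-reflects (cong proj₁) (λ p → Σ-prop-path isEquiv-isProp p _ _)
        (λ p → Σ-prop-path-proj₁ isEquiv-isProp p (idIsEquiv Z) (idIsEquiv Z)) ρ≡refl)

module BAutLoops (U : UnivalenceAll) (pt : PropTrunc) where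
  open Univalent U
  open PropTrunc pt

  BAut-elim-prop : {ℓ' : Level} {Y : Set ℓ} (P : Set ℓ → Set ℓ') → ((Z : Set ℓ) → isProp (P Z)) →
                   P Y → (x : BAut pt Y) → P (proj₁ x)
  BAut-elim-prop P isP pY (Z , t) = rec (isP Z) (λ p → subst P (sym p) pY) t

  loop : {Y Z : Set ℓ} (t : ∥ Z ≡ Y ∥) → Z ≃ Z → _≡_ {A = BAut pt Y} (Z , t) (Z , t)
  loop t e = Σ-prop-path (λ _ → squash) (ua e) t t

  loopEquiv : {Y : Set ℓ} {x : BAut pt Y} → x ≡ x → proj₁ x ≃ proj₁ x
  loopEquiv l = idtoeqv (cong proj₁ l)

  loopEquiv-loop : {Y Z : Set ℓ} (t : ∥ Z ≡ Y ∥) (e : Z ≃ Z) → loopEquiv (loop t e) ≡ e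
  loopEquiv-loop t e = trans (cong idtoeqv (Σ-prop-path-proj₁ (λ _ → squash) (ua e) t t)) (ua-β e)

  loop-loopEquiv : {Y Z : Set ℓ} (t : ∥ Z ≡ Y ∥) (l : _≡_ {A = BAut pt Y} (Z , t) (Z , t)) →
                   l ≡ loop t (loopEquiv l)
  loop-loopEquiv t l =
    trans (Σ-prop-path-η (λ _ → squash) l)
          (cong (λ q → Σ-prop-path (λ _ → squash) q t t) (sym (ua-η (cong proj₁ l))))

  loop-id : {Y Z : Set ℓ} (t : ∥ Z ≡ Y ∥) → loop t (idtoeqv refl) ≡ refl
  loop-id t = sym (loop-loopEquiv t refl)

  NontrivialLoop : {Z : Set ℓ} → Z → Set ℓ
  NontrivialLoop z = Σ (z ≡ z) (λ l → ¬ (l ≡ refl))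

  negation-loop-unique : (s : ∥ Bool ≡ Bool ∥) →
                         isContr (NontrivialLoop {Z = BAut pt Bool} (Bool , s))
  negation-loop-unique s = (loop s notE , negation-nontrivial) , unique
    where
    negation-nontrivial : ¬ (loop s notE ≡ refl)
    negation-nontrivial w with () ← cong (λ e → proj₁ e true)
      (retraction-reflects loopEquiv (loop s) (loopEquiv-loop s) w)
    unique : (c : NontrivialLoop (Bool , s)) → (loop s notE , negation-nontrivial) ≡ c
    unique (l , nl) with Bool-automorphism (loopEquiv l)
    ... | inj₁ e≡id  = ⊥-elim (nl (trans (loop-loopEquiv s l) (trans (cong (loop s) e≡id) (loop-id s))))
    ... | inj₂ e≡not = Σ-prop-path (λ _ → ¬-isProp)
                         (sym (trans (loop-loopEquiv s l) (cong (loop s) e≡not))) negation-nontrivial nl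

  BAut2-nontrivial-loop : (y : BAut pt Bool) → isContr (NontrivialLoop y)
  BAut2-nontrivial-loop (W , s) =
    BAut-elim-prop (λ W → (s : ∥ W ≡ Bool ∥) → isContr (NontrivialLoop {Z = BAut pt Bool} (W , s)))
      (λ _ → Π-isProp λ _ → isContr-isProp) negation-loop-unique (W , s) s

  nontrivial-loop : {Z : Set₁} → ∥ Z ≡ BAut pt Bool ∥ → (z : Z) → isContr (NontrivialLoop z)
  nontrivial-loop {Z} t =
    BAut-elim-prop (λ Z → (z : Z) → isContr (NontrivialLoop z))
      (λ _ → Π-isProp λ _ → isContr-isProp) BAut2-nontrivial-loop (Z , t)

  central : {Y Z : Set ℓ} (t : ∥ Z ≡ Y ∥) → ((z : Z) → z ≡ z) →
            refl {x = _,_ {B = λ Z → ∥ Z ≡ Y ∥} Z t} ≡ refl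
  central t H = trans (sym (loop-id t)) (trans (cong (loop t) (identity-loop H)) (loop-id t))

  central-faithful : {Y Z : Set ℓ} (t : ∥ Z ≡ Y ∥) (H : (z : Z) → z ≡ z) →
                     central t H ≡ refl → H ≡ (λ z → refl)
  central-faithful t H w =
    identity-loop-faithful H
      (section-loop-refl (loop t) loopEquiv (λ e → sym (loopEquiv-loop t e)) (identity-loop H)
        (conjugate-refl (loop-id t) _ w))

theorem7p4 : UnivalenceAll → (pt : PropTrunc) →
    Σ ((x : X pt) → refl {x = x} ≡ refl {x = x})
      (λ f → ¬ (f ≡ (λ x → refl {x = refl {x = x}})))
theorem7p4 U pt = twist , twist-nontrivial
  where
  open BAutLoops U pt
  open PropTrunc pt using (∣_∣)
  H : (x : X pt) (z : proj₁ x) → z ≡ z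
  H x z = proj₁ (proj₁ (nontrivial-loop (proj₂ x) z))
  twist : (x : X pt) → refl {x = x} ≡ refl
  twist x = central (proj₂ x) (H x)
  base : X pt
  base = BAut pt Bool , ∣ refl ∣
  point : BAut pt Bool
  point = Bool , ∣ refl ∣
  H-nontrivial : ¬ (H base point ≡ refl)
  H-nontrivial = proj₂ (proj₁ (nontrivial-loop (proj₂ base) point))
  twist-nontrivial : ¬ (twist ≡ (λ x → refl))
  twist-nontrivial w = H-nontrivial (cong-app (central-faithful (proj₂ base) (H base) (cong-app w base)) point)
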